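{- Let $k \geq 2$ be an integer, let $G$ be a $(K_2 \cup kK_1)$-free graph, and let $X \subset V(G)$ be an independent set. Then: (1) every vertex $v \in V(G)$ satisfies either $N_G(v) \cap X = \emptyset$ or $|N_G(v) \cap X| \geq |X| - k + 1$; (2) if $W \subset V(G)$ is such that every $w \in W$ satisfies $|N_G(w) \cap X| \leq |X| - k$, then $X \cup W$ is an independent set in $G$.
   Context: All graphs are finite, undirected and simple. $K_2 \cup kK_1$ denotes the disjoint union of one edge and $k$ isolated vertices; a graph is $(K_2 \cup kK_1)$-free if it has no induced subgraph isomorphic to $K_2 \cup kK_1$. $N_G(v)$ denotes the neighborhood of $v$. -}

module Defs where

open import Data.Nat using (ℕ; _+_; _∸_; _≤_; _≥_)
open import Data.Fin using (Fin)
open import Data.Fin.Subset using (Subset; _∈_; _∩_; _∪_; ∣_∣; Empty; inside; outside)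
open import Data.Vec using (tabulate)
open import Data.Product using (Σ; _×_; _,_)
open import Relation.Nullary using (¬_; Dec; does)
open import Relation.Binary.PropositionalEquality using (_≡_; _≢_)
open import Function.Definitions using (Injective)

record Graph (n : ℕ) : Set₁ where
  field
    Adj    : Fin n → Fin n → Set
    adj?   : (u v : Fin n) → Dec (Adj u v)
    sym    : ∀ {u v} → Adj u v → Adj v u
    irrefl : ∀ {u} → ¬ Adj u u
open Graph public

N : ∀ {n} → Graph n → Fin n → Subset n
N G v = tabulate λ u → if does (adj? G v u) then inside else outside
  where
    open import Data.Bool using (if_then_else_)

Independent : ∀ {n} → Graph n → Subset n → Set
Independent G X = ∀ u v → u ∈ X → v ∈ X → ¬ Adj G u v

HasInducedK2kK1 : ∀ {n} → ℕ → Graph n → Set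
HasInducedK2kK1 {n} k G =
  Σ (Fin n) λ u → Σ (Fin n) λ v → Σ (Fin k → Fin n) λ w →
    Adj G u v
    × Injective _≡_ _≡_ w
    × (∀ i → w i ≢ u) × (∀ i → w i ≢ v)
    × (∀ i → ¬ Adj G u (w i)) × (∀ i → ¬ Adj G v (w i))
    × (∀ i j → ¬ Adj G (w i) (w j))

K2kK1-free : ∀ {n} → ℕ → Graph n → Set
K2kK1-free k G = ¬ HasInducedK2kK1 k G

-- If v is adjacent to some x ∈ X, then the edge vx together with any k vertices of X ∖ N(v)
-- spans an induced K₂ ∪ kK₁ (X is independent, and none of these vertices meets v or x),
-- so |X ∖ N(v)| < k. Likewise an edge inside W, whose ends both miss X, together with any
-- k vertices of X spans an induced K₂ ∪ kK₁.
module Submission where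

open import Defs
open import Data.Nat using (ℕ; suc; _+_; _≤_; _≥_)
open import Data.Nat.Properties using (+-comm; +-suc; +-cancelˡ-≤; ≤-trans; ≤-reflexive; m≤n+m; _≤?_; ≰⇒>)
open import Data.Fin using (Fin; zero; suc; inject≤)
open import Data.Fin.Properties using (suc-injective; inject≤-injective)
open import Data.Fin.Subset using (Subset; _∈_; _∩_; _∪_; _⊆_; ∁; ∣_∣; Empty; inside; outside)
open import Data.Fin.Subset.Properties using (∩-comm; p∩q⊆p; x∈p∩q⁺; x∈p∩q⁻; x∈p∪q⁻; x∈∁p⇒x∉p)
open import Data.Vec using ([]; _∷_; lookup; here; there)
open import Data.Vec.Properties using (lookup∘tabulate; []=⇒lookup; lookup⇒[]=)
open import Data.Bool using (if_then_else_)
open import Data.Product using (Σ-syntax; _×_; _,_; proj₁; proj₂)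
open import Data.Sum using (_⊎_; inj₁; inj₂)
open import Function using (_∘_)
open import Function.Definitions using (Injective)
open import Relation.Nullary using (¬_; yes; no; does; contradiction)
open import Relation.Binary.PropositionalEquality using (_≡_; refl; trans; cong; subst)
  renaming (sym to ≡-sym)

private
  variable
    n k : ℕ

∣p∩q∣+∣p∩∁q∣≡∣p∣ : (p q : Subset n) → ∣ p ∩ q ∣ + ∣ p ∩ ∁ q ∣ ≡ ∣ p ∣
∣p∩q∣+∣p∩∁q∣≡∣p∣ []            []            = refl
∣p∩q∣+∣p∩∁q∣≡∣p∣ (outside ∷ p) (_       ∷ q) = ∣p∩q∣+∣p∩∁q∣≡∣p∣ p q
∣p∩q∣+∣p∩∁q∣≡∣p∣ (inside  ∷ p) (inside  ∷ q) = cong suc (∣p∩q∣+∣p∩∁q∣≡∣p∣ p q)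
∣p∩q∣+∣p∩∁q∣≡∣p∣ (inside  ∷ p) (outside ∷ q) =
  trans (+-suc ∣ p ∩ q ∣ ∣ p ∩ ∁ q ∣) (cong suc (∣p∩q∣+∣p∩∁q∣≡∣p∣ p q))

DistinctElements : ℕ → Subset n → Set
DistinctElements {n} k S = Σ[ f ∈ (Fin k → Fin n) ] Injective _≡_ _≡_ f × (∀ i → f i ∈ S)

enumerate : (S : Subset n) → DistinctElements ∣ S ∣ S
enumerate []            = (λ ()) , (λ {}) , (λ ())
enumerate (outside ∷ S) with enumerate S
... | f , f-inj , f∈S = suc ∘ f , f-inj ∘ suc-injective , there ∘ f∈S
enumerate (inside  ∷ S) with enumerate S
... | f , f-inj , f∈S = g , g-inj , g∈S
  where
    g : Fin (suc ∣ S ∣) → Fin _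
    g zero    = zero
    g (suc i) = suc (f i)

    g-inj : Injective _≡_ _≡_ g
    g-inj {zero}  {zero}  _  = refl
    g-inj {suc i} {suc j} eq = cong suc (f-inj (suc-injective eq))

    g∈S : ∀ i → g i ∈ inside ∷ S
    g∈S zero    = here
    g∈S (suc i) = there (f∈S i)

choose : {S : Subset n} → k ≤ ∣ S ∣ → DistinctElements k S
choose {S = S} k≤∣S∣ with enumerate S
... | f , f-inj , f∈S =
  f ∘ inject≤′ , inject≤-injective k≤∣S∣ k≤∣S∣ _ _ ∘ f-inj , f∈S ∘ inject≤′
  where inject≤′ = λ i → inject≤ i k≤∣S∣

module _ (G : Graph n) where

  lookup-N : ∀ v u → lookup (N G v) u ≡ (if does (adj? G v u) then inside else outside)
  lookup-N v u = lookup∘tabulate _ u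

  ∈N⇒Adj : ∀ {v u} → u ∈ N G v → Adj G v u
  ∈N⇒Adj {v} {u} u∈N with adj? G v u | trans (≡-sym (lookup-N v u)) ([]=⇒lookup u∈N)
  ... | yes vu | _ = vu
  ... | no _   | ()

  Adj⇒∈N : ∀ {v u} → Adj G v u → u ∈ N G v
  Adj⇒∈N {v} {u} vu = lookup⇒[]= u _ (trans (lookup-N v u) decided-inside)
    where
      decided-inside : (if does (adj? G v u) then inside else outside) ≡ inside
      decided-inside with adj? G v u
      ... | yes _  = refl
      ... | no ¬vu = contradiction vu ¬vu

  independent-⊆ : ∀ {S T} → S ⊆ T → Independent G T → Independent G S
  independent-⊆ S⊆T indT u v u∈S v∈S = indT u v (S⊆T u∈S) (S⊆T v∈S)

  independent-∪ : ∀ {S T} → Independent G S → Independent G T →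
    (∀ s t → s ∈ S → t ∈ T → ¬ Adj G t s) → Independent G (S ∪ T)
  independent-∪ {S} {T} indS indT S≁T u v u∈ v∈ uv with x∈p∪q⁻ S T u∈ | x∈p∪q⁻ S T v∈
  ... | inj₁ u∈S | inj₁ v∈S = indS u v u∈S v∈S uv
  ... | inj₁ u∈S | inj₂ v∈T = S≁T u v u∈S v∈T (sym G uv)
  ... | inj₂ u∈T | inj₁ v∈S = S≁T v u v∈S u∈T uv
  ... | inj₂ u∈T | inj₂ v∈T = indT u v u∈T v∈T uv

  -- u, v ∉ S is not assumed: it follows from uv being an edge with both ends missing S.
  edge-missing-independent⇒K2kK1 : ∀ {u v} {S : Subset n} → Adj G u v →
    Independent G S → k ≤ ∣ S ∣ →
    (∀ s → s ∈ S → ¬ Adj G u s) → (∀ s → s ∈ S → ¬ Adj G v s) → HasInducedK2kK1 k G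
  edge-missing-independent⇒K2kK1 {u = u} {v} {S} uv indS k≤∣S∣ u≁S v≁S
    with choose k≤∣S∣
  ... | w , w-inj , w∈S =
    u , v , w , uv , w-inj , w≢u , w≢v
      , (λ i → u≁S (w i) (w∈S i)) , (λ i → v≁S (w i) (w∈S i))
      , (λ i j → indS (w i) (w j) (w∈S i) (w∈S j))
    where
      w≢u : ∀ i → ¬ w i ≡ u
      w≢u i eq = v≁S u (subst (_∈ S) eq (w∈S i)) (sym G uv)

      w≢v : ∀ i → ¬ w i ≡ v
      w≢v i eq = u≁S v (subst (_∈ S) eq (w∈S i)) uv

  few-neighbours-in-independent⇒none : K2kK1-free k G → ∀ {X} → Independent G X →
    ∀ v → ∣ N G v ∩ X ∣ + k ≤ ∣ X ∣ → Empty (N G v ∩ X)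
  few-neighbours-in-independent⇒none {k} free {X} indX v bound (x , x∈N∩X)
    with x∈p∩q⁻ (N G v) X x∈N∩X
  ... | x∈N , x∈X = free (edge-missing-independent⇒K2kK1 (∈N⇒Adj x∈N)
          (independent-⊆ (p∩q⊆p X (∁ (N G v))) indX) k≤∣X∖N∣ v≁X∖N x≁X∖N)
    where
      X∖N = X ∩ ∁ (N G v)

      ∣N∩X∣+∣X∖N∣≡∣X∣ : ∣ N G v ∩ X ∣ + ∣ X∖N ∣ ≡ ∣ X ∣
      ∣N∩X∣+∣X∖N∣≡∣X∣ =
        trans (cong (λ A → ∣ A ∣ + ∣ X∖N ∣) (∩-comm (N G v) X)) (∣p∩q∣+∣p∩∁q∣≡∣p∣ X (N G v))

      k≤∣X∖N∣ : k ≤ ∣ X∖N ∣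
      k≤∣X∖N∣ = +-cancelˡ-≤ (∣ N G v ∩ X ∣) k (∣ X∖N ∣)
                  (≤-trans bound (≤-reflexive (≡-sym ∣N∩X∣+∣X∖N∣≡∣X∣)))

      v≁X∖N : ∀ s → s ∈ X∖N → ¬ Adj G v s
      v≁X∖N s s∈ vs = x∈∁p⇒x∉p (proj₂ (x∈p∩q⁻ X _ s∈)) (Adj⇒∈N vs)

      x≁X∖N : ∀ s → s ∈ X∖N → ¬ Adj G x s
      x≁X∖N s s∈ = indX x s x∈X (proj₁ (x∈p∩q⁻ X _ s∈))

lemma2p3 : (k : ℕ) → 2 ≤ k → {n : ℕ} → (G : Graph n) → K2kK1-free k G →
    (X : Subset n) → Independent G X →
    ((v : Fin n) → Empty (N G v ∩ X) ⊎ ∣ N G v ∩ X ∣ + k ≥ ∣ X ∣ + 1)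
    × ((W : Subset n) → (∀ w → w ∈ W → ∣ N G w ∩ X ∣ + k ≤ ∣ X ∣) →
       Independent G (X ∪ W))
lemma2p3 k _ G free X indX = empty-or-dense , independent-X∪W
  where
    empty-or-dense : (v : Fin _) → Empty (N G v ∩ X) ⊎ ∣ N G v ∩ X ∣ + k ≥ ∣ X ∣ + 1
    empty-or-dense v with ∣ N G v ∩ X ∣ + k ≤? ∣ X ∣
    ... | yes sparse = inj₁ (few-neighbours-in-independent⇒none G free indX v sparse)
    ... | no ¬sparse = inj₂ (subst (_≤ ∣ N G v ∩ X ∣ + k) (+-comm 1 ∣ X ∣) (≰⇒> ¬sparse))

    independent-X∪W : (W : Subset _) → (∀ w → w ∈ W → ∣ N G w ∩ X ∣ + k ≤ ∣ X ∣) →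
      Independent G (X ∪ W)
    independent-X∪W W sparse = independent-∪ G indX indW X≁W
      where
        X≁W : ∀ x w → x ∈ X → w ∈ W → ¬ Adj G w x
        X≁W x w x∈X w∈W wx = few-neighbours-in-independent⇒none G free indX w (sparse w w∈W)
          (x , x∈p∩q⁺ (Adj⇒∈N G wx , x∈X))

        indW : Independent G W
        indW u v u∈W v∈W uv = free (edge-missing-independent⇒K2kK1 G uv indX
          (≤-trans (m≤n+m k _) (sparse u u∈W))
          (λ x x∈X → X≁W x u x∈X u∈W) (λ x x∈X → X≁W x v x∈X v∈W))
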